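{- Let $Y=(|Y|,\delta_Y)$ be a represented space, let $|X|$ be a set admitting some representation $\delta_X:\subseteq\mathbb{N}^{\mathbb{N}}\to|X|$, and let $f:|X|\to|Y|$ be an arbitrary function. Then there exists a representation $\delta_X^f:\subseteq\mathbb{N}^{\mathbb{N}}\to|X|$ such that $f:(|X|,\delta_X^f)\to(|Y|,\delta_Y)$ is Type-2 computable, i.e. has a computable realizer.
   Context: A representation of a set $S$ is a partial surjection $\delta:\subseteq\mathbb{N}^{\mathbb{N}}\to S$. A partial $F:\subseteq\mathbb{N}^{\mathbb{N}}\to\mathbb{N}^{\mathbb{N}}$ realizes $f$ with respect to $\delta_X,\delta_Y$ if $\delta_Y(F(p))=f(\delta_X(p))$ for all $p\in\mathrm{dom}(\delta_X)$. -}

module Defs where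

open import Data.Nat using (ℕ; zero; suc; _<_)
open import Data.Fin using (Fin)
open import Data.Vec using (Vec; []; _∷_; lookup)
open import Data.Product using (Σ; ∃; _×_; _,_)
open import Relation.Binary.PropositionalEquality using (_≡_)

Baire : Set
Baire = ℕ → ℕ

_≈B_ : Baire → Baire → Set
p ≈B q = ∀ n → p n ≡ q n

-- Representations: a partial surjection δ :⊆ ℕ^ℕ → S, given by its graph
-- (p ⊩ s  means  p ∈ dom δ and δ(p) = s).

record Representation (S : Set) : Set₁ where
  field
    _⊩_           : Baire → S → Set
    single-valued : ∀ {p s s′} → p ⊩ s → p ⊩ s′ → s ≡ s′
    -- δ is a (set-theoretic) function on ℕ^ℕ, so it respects pointwise equality
    extensional   : ∀ {p q s} → p ≈B q → p ⊩ s → q ⊩ s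
    surjective    : ∀ s → ∃ λ p → p ⊩ s

open Representation public

-- Partial recursive functions relative to an oracle p ∈ ℕ^ℕ
-- (μ-recursive codes with an extra oracle primitive).

data Code : ℕ → Set where
  zeroᶜ  : ∀ {n} → Code n
  succᶜ  : Code 1
  projᶜ  : ∀ {n} → Fin n → Code n
  oracle : Code 1
  comp   : ∀ {m n} → Code m → Vec (Code n) m → Code n
  prec   : ∀ {n} → Code n → Code (suc (suc n)) → Code (suc n)
  mu     : ∀ {n} → Code (suc n) → Code n

-- Big-step semantics: Eval e p xs r  means  Φ_e^p(xs) ↓ = r.
mutual
  data Eval (p : Baire) : ∀ {n} → Code n → Vec ℕ n → ℕ → Set where
    ev-zero   : ∀ {n} {xs : Vec ℕ n} → Eval p zeroᶜ xs 0
    ev-succ   : ∀ {x} → Eval p succᶜ (x ∷ []) (suc x)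
    ev-proj   : ∀ {n} {i : Fin n} {xs} → Eval p (projᶜ i) xs (lookup xs i)
    ev-oracle : ∀ {x} → Eval p oracle (x ∷ []) (p x)
    ev-comp   : ∀ {m n} {g : Code m} {hs : Vec (Code n) m} {xs ys r} →
                EvalVec p hs xs ys → Eval p g ys r → Eval p (comp g hs) xs r
    ev-prec-z : ∀ {n} {g : Code n} {h} {xs r} →
                Eval p g xs r → Eval p (prec g h) (0 ∷ xs) r
    ev-prec-s : ∀ {n} {g : Code n} {h} {k xs r r′} →
                Eval p (prec g h) (k ∷ xs) r → Eval p h (k ∷ r ∷ xs) r′ →
                Eval p (prec g h) (suc k ∷ xs) r′
    ev-mu     : ∀ {n} {g : Code (suc n)} {xs y} →
                Eval p g (y ∷ xs) 0 →
                (∀ z → z < y → ∃ λ k → Eval p g (z ∷ xs) (suc k)) →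
                Eval p (mu g) xs y

  data EvalVec (p : Baire) {n : ℕ} : ∀ {m} → Vec (Code n) m → Vec ℕ n → Vec ℕ m → Set where
    []  : ∀ {xs} → EvalVec p [] xs []
    _∷_ : ∀ {m} {h : Code n} {hs : Vec (Code n) m} {xs r rs} →
          Eval p h xs r → EvalVec p hs xs rs → EvalVec p (h ∷ hs) xs (r ∷ rs)

Computes : Code 1 → Baire → Baire → Set
Computes e p q = ∀ n → Eval p e (n ∷ []) (q n)

Computable : ∀ {S T : Set} → Representation S → Representation T → (S → T) → Set
Computable δS δT f =
  ∃ λ (e : Code 1) → ∀ p s → _⊩_ δS p s →
    ∃ λ q → Computes e p q × _⊩_ δT q (f s)

-- Let a name of x be a name p of x interleaved with a name q of f(x).
-- This is again a representation of X, and reading off q from the odd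
-- positions is a computable realizer of f, however complicated f is.
module Submission where

open import Defs
open import Data.Product using (Σ; _,_; proj₁; proj₂)
open import Data.Nat using (zero; suc; _+_)
open import Data.Nat.Properties using (+-suc)
open import Data.Fin using () renaming (zero to fzero; suc to fsuc)
open import Data.Vec using ([]; _∷_)
open import Function using (_∘_)
open import Relation.Binary.PropositionalEquality using (refl; sym; trans; cong)

evens : Baire → Baire
evens p n = p (n + n)

odds : Baire → Baire
odds p n = p (suc (n + n))

interleave : Baire → Baire → Baire
interleave a b zero          = a 0
interleave a b (suc zero)    = b 0
interleave a b (suc (suc n)) = interleave (a ∘ suc) (b ∘ suc) n

evens-interleave : ∀ a b → evens (interleave a b) ≈B a
evens-interleave a b zero    = refl
evens-interleave a b (suc m) =
  trans (cong (interleave a b ∘ suc) (+-suc m m))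
        (evens-interleave (a ∘ suc) (b ∘ suc) m)

odds-interleave : ∀ a b → odds (interleave a b) ≈B b
odds-interleave a b zero    = refl
odds-interleave a b (suc m) =
  trans (cong (interleave a b ∘ suc ∘ suc) (+-suc m m))
        (odds-interleave (a ∘ suc) (b ∘ suc) m)

enriched : {X Y : Set} → Representation X → (X → Y) → Representation Y → Representation X
enriched δX f δY = record
  { _⊩_           = λ p x → Σ (_⊩_ δX (evens p) x) (λ _ → _⊩_ δY (odds p) (f x))
  ; single-valued = λ p⊩x p⊩x′ → single-valued δX (proj₁ p⊩x) (proj₁ p⊩x′)
  ; extensional   = λ p≈q (a⊩x , b⊩fx) →
      extensional δX (λ n → p≈q (n + n)) a⊩x , extensional δY (λ n → p≈q (suc (n + n))) b⊩fx
  ; surjective    = λ x →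
      let (a , a⊩x)  = surjective δX x
          (b , b⊩fx) = surjective δY (f x)
      in  interleave a b
        , extensional δX (sym ∘ evens-interleave a b) a⊩x
        , extensional δY (sym ∘ odds-interleave a b) b⊩fx
  }

addᶜ : Code 2
addᶜ = prec (projᶜ fzero) (comp succᶜ (projᶜ (fsuc fzero) ∷ []))

eval-add : ∀ p m n → Eval p addᶜ (m ∷ n ∷ []) (m + n)
eval-add p zero    n = ev-prec-z ev-proj
eval-add p (suc m) n = ev-prec-s (eval-add p m n) (ev-comp (ev-proj ∷ []) ev-succ)

oddsᶜ : Code 1
oddsᶜ = comp oracle (comp succᶜ (comp addᶜ (projᶜ fzero ∷ projᶜ fzero ∷ []) ∷ []) ∷ [])

computes-odds : ∀ p → Computes oddsᶜ p (odds p)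
computes-odds p n =
  ev-comp (ev-comp (ev-comp (ev-proj ∷ ev-proj ∷ []) (eval-add p n n) ∷ []) ev-succ ∷ [])
          ev-oracle

enriched-computable : {X Y : Set} (δX : Representation X) (f : X → Y) (δY : Representation Y) →
                      Computable (enriched δX f δY) δY f
enriched-computable δX f δY = oddsᶜ , λ p x (_ , odds-p⊩fx) → odds p , computes-odds p , odds-p⊩fx

mainTheorem14 : {X Y : Set} → (δY : Representation Y) → (δX : Representation X) → (f : X → Y) →
    Σ (Representation X) (λ δXf → Computable δXf δY f)
mainTheorem14 δY δX f = enriched δX f δY , enriched-computable δX f δY
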